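{- Let $\mathsf L\in\{\mathsf N_\preccurlyeq,\mathsf{NN}_\preccurlyeq,\mathsf{NT}_\preccurlyeq,\mathsf{NW}_\preccurlyeq,\mathsf{NC}_\preccurlyeq,\mathsf{NA}_\preccurlyeq,\mathsf{NNA}_\preccurlyeq\}$ and let $\mathsf{H.L}$ be the corresponding hypersequent calculus. For every formula $A$, if (the hypersequent $\Rightarrow A$) is derivable in $\mathsf{H.L}$, then $A$ is valid in all $\mathsf L$-models.
   Context: Language: formulas $A ::= p \mid \bot \mid A\to A \mid A \preccurlyeq A$ over a countable set $Atm$ of atoms; $\top,\neg,\wedge,\vee$ defined as usual. A neighbourhood model is $\langle W,N,V\rangle$ with $W\ne\emptyset$, $V:Atm\to\mathcal P(W)$, $N:W\to\mathcal P(\mathcal P(W))$ with $\emptyset\notin N(w)$. Forcing: $w\Vdash p$ iff $w\in V(p)$; $w\not\Vdash\bot$; $w\Vdash B\to C$ iff $w\Vdash B$ implies $w\Vdash C$; $w\Vdash B\preccurlyeq C$ iff for all $\alpha\in N(w)$, if some $v\in\alpha$ forces $C$ then some $u\in\alpha$ forces $B$. Validity in a model: forced at all worlds. Conditions (for all $w$): (N) $N(w)\ne\emptyset$; (T) some $\alpha\in N(w)$ contains $w$; (W) $N(w)\ne\emptyset$ and every $\alpha\in N(w)$ contains $w$; (C) $\{w\}\in N(w)$ and every $\alpha\in N(w)$ contains $w$; (A) if $\alpha\in N(w)$ and $v\in\alpha$ then $N(v)=N(w)$. $\mathsf L$-models: $\mathsf N_\preccurlyeq$: all; $\mathsf{NN}_\preccurlyeq$: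 (N); $\mathsf{NT}_\preccurlyeq$: (T); $\mathsf{NW}_\preccurlyeq$: (W); $\mathsf{NC}_\preccurlyeq$: (C); $\mathsf{NA}_\preccurlyeq$: (A); $\mathsf{NNA}_\preccurlyeq$: (N) and (A). Hypersequents: a block $[\Sigma\lhd A]$ consists of a finite multiset $\Sigma$ of formulas and a formula $A$; a sequent with blocks $\Gamma\Rightarrow\Delta$ has $\Gamma$ a finite multiset of formulas and $\Delta$ a finite multiset of formulas and blocks; a hypersequent is a finite multiset $\Gamma_1\Rightarrow\Delta_1\mid\dots\mid\Gamma_n\Rightarrow\Delta_n$ of sequents with blocks (components). Rules ($\mathcal G$ denotes the remaining components): init: $\mathcal G\mid\Gamma,p\Rightarrow p,\Delta$; $\bot_L$: $\mathcal G\mid\Gamma,\bot\Rightarrow\Delta$; $\to_L$: from $\mathcal G\mid\Gamma,A\to B,B\Rightarrow\Delta$ and $\mathcal G\mid\Gamma,A\to B\Rightarrow\Delta,A$ infer $\mathcal G\mid\Gamma,A\to B\Rightarrow\Delta$; $\to_R$: from $\mathcal G\mid\Gamma,A\Rightarrow\Delta,A\to B,B$ infer $\mathcal G\mid\Gamma\Rightarrow\Delta,A\to B$; $\preccurlyeq_L$: from $\mathcal G\mid\Gamma,A\preccurlyeq B\Rightarrow\Delta,[B,\Sigma\lhd C]$ and $\mathcal G\mid\Gamma,A\preccurlyeq B\Rightarrow\Delta,[\Sigma\lhd C],[\Sigma\lhd A]$ infer $\mathcal G\mid\Gamma,A\preccurlyeq B\Rightarrow\Delta,[\Sigma\lhd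 C]$; $\preccurlyeq_R$: from $\mathcal G\mid\Gamma\Rightarrow\Delta,A\preccurlyeq B,[A\lhd B]$ infer $\mathcal G\mid\Gamma\Rightarrow\Delta,A\preccurlyeq B$; jp: from $\mathcal G\mid\Gamma\Rightarrow\Delta,[\Sigma\lhd A]\mid A\Rightarrow\Sigma$ infer $\mathcal G\mid\Gamma\Rightarrow\Delta,[\Sigma\lhd A]$; N: from $\mathcal G\mid\Gamma\Rightarrow\Delta,[\bot\lhd\top]$ infer $\mathcal G\mid\Gamma\Rightarrow\Delta$; T: from $\mathcal G\mid\Gamma,A\preccurlyeq B\Rightarrow\Delta,B$ and $\mathcal G\mid\Gamma,A\preccurlyeq B\Rightarrow\Delta,[\bot\lhd A]$ infer $\mathcal G\mid\Gamma,A\preccurlyeq B\Rightarrow\Delta$; W: from $\mathcal G\mid\Gamma\Rightarrow\Delta,[\Sigma\lhd A],\Sigma$ infer $\mathcal G\mid\Gamma\Rightarrow\Delta,[\Sigma\lhd A]$; C: from $\mathcal G\mid\Gamma,A\preccurlyeq B\Rightarrow\Delta,B$ and $\mathcal G\mid\Gamma,A\preccurlyeq B,A\Rightarrow\Delta$ infer $\mathcal G\mid\Gamma,A\preccurlyeq B\Rightarrow\Delta$; $\mathrm A_L$: from $\mathcal G\mid\Gamma,A\preccurlyeq B\Rightarrow\Delta\mid\Omega,A\preccurlyeq B\Rightarrow\Theta$ infer $\mathcal G\mid\Gamma,A\preccurlyeq B\Rightarrow\Delta\mid\Omega\Rightarrow\Theta$; $\mathrm A_R$: from $\mathcal G\mid\Gamma\Rightarrow\Delta,A\preccurlyeq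 B\mid\Omega\Rightarrow\Theta,A\preccurlyeq B$ infer $\mathcal G\mid\Gamma\Rightarrow\Delta,A\preccurlyeq B\mid\Omega\Rightarrow\Theta$. Calculi: $\mathsf{H.N}=\{\mathrm{init},\bot_L,\to_L,\to_R,\preccurlyeq_L,\preccurlyeq_R,\mathrm{jp}\}$; $\mathsf{H.NN}=\mathsf{H.N}+$N; $\mathsf{H.NT}=\mathsf{H.N}+$T; $\mathsf{H.NW}=\mathsf{H.N}+$T,W; $\mathsf{H.NC}=\mathsf{H.N}+$W,C; $\mathsf{H.NA}=\mathsf{H.N}+\mathrm A_L,\mathrm A_R$; $\mathsf{H.NNA}=\mathsf{H.NN}+\mathrm A_L,\mathrm A_R$. The calculus for $\mathsf NX_\preccurlyeq$ is $\mathsf{H.N}X$. -}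

module Defs where

open import Data.Nat using (ℕ)
open import Data.List using (List; []; _∷_; _++_)
open import Data.Product using (Σ; _×_; _,_)
open import Data.Sum using (_⊎_)
open import Data.Empty.Polymorphic using (⊥)
open import Level using (Lift)
open import Relation.Nullary using (¬_)
open import Relation.Binary.PropositionalEquality using (_≡_)
open import Data.List.Relation.Binary.Permutation.Propositional using (_↭_)
open import Data.List.Relation.Binary.Permutation.Homogeneous using (Permutation)

infixr 6 _⊃_
infix 7 _≼_

data Fm : Set where
  atom : ℕ → Fm
  bot  : Fm
  _⊃_  : Fm → Fm → Fm
  _≼_  : Fm → Fm → Fm

top : Fm
top = bot ⊃ bot

record Model : Set₁ where
  field
    W     : Set
    w₀    : W                                   -- W ≠ ∅
    V     : ℕ → W → Set
    N     : W → (W → Set) → Set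
    noEmp : ∀ w α → N w α → Σ W α               -- ∅ ∉ N(w)

module _ (M : Model) where
  open Model M

  infix 4 _⊩_
  _⊩_ : W → Fm → Set₁
  w ⊩ atom p = Lift _ (V p w)
  w ⊩ bot    = ⊥
  w ⊩ B ⊃ C  = w ⊩ B → w ⊩ C
  w ⊩ B ≼ C  = ∀ α → N w α →
               Σ W (λ v → α v × v ⊩ C) → Σ W (λ u → α u × u ⊩ B)

  ValidIn : Fm → Set₁
  ValidIn A = ∀ w → w ⊩ A

  CondN CondT CondW CondC CondA : Set₁
  CondN = ∀ w → Σ (W → Set) (λ α → N w α)
  CondT = ∀ w → Σ (W → Set) (λ α → N w α × α w)
  CondW = ∀ w → Σ (W → Set) (λ α → N w α) × (∀ α → N w α → α w)
  CondC = ∀ w → N w (λ v → v ≡ w) × (∀ α → N w α → α w)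
  CondA = ∀ w α v → N w α → α v →
          ∀ β → (N v β → N w β) × (N w β → N v β)

data Logic : Set where
  N≼ NN≼ NT≼ NW≼ NC≼ NA≼ NNA≼ : Logic

IsModelOf : Logic → Model → Set₁
IsModelOf N≼   M = Data.Unit.Polymorphic.⊤ where import Data.Unit.Polymorphic
IsModelOf NN≼  M = CondN M
IsModelOf NT≼  M = CondT M
IsModelOf NW≼  M = CondW M
IsModelOf NC≼  M = CondC M
IsModelOf NA≼  M = CondA M
IsModelOf NNA≼ M = CondN M × CondA M

ValidL : Logic → Fm → Set₁
ValidL L A = ∀ (M : Model) → IsModelOf L M → ValidIn M A

-- Hypersequents.  Multisets are represented by lists, and derivability
-- is closed under multiset equality (permutation at every level).

record Block : Set where
  constructor [_◁_]
  field
    ctx : List Fm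
    fml : Fm

-- A sequent with blocks Γ ⇒ Δ; the succedent multiset Δ of formulas and
-- blocks is split into its formula part and its block part.
record Seq : Set where
  constructor _⇒_∣_
  field
    ant   : List Fm
    sucF  : List Fm
    sucB  : List Block

Hyp : Set
Hyp = List Seq

BlockEq : Block → Block → Set
BlockEq [ Σ₁ ◁ A ] [ Σ₂ ◁ B ] = (Σ₁ ↭ Σ₂) × (A ≡ B)

SeqEq : Seq → Seq → Set
SeqEq (Γ₁ ⇒ Δ₁ ∣ B₁) (Γ₂ ⇒ Δ₂ ∣ B₂) =
  (Γ₁ ↭ Γ₂) × (Δ₁ ↭ Δ₂) × Permutation BlockEq B₁ B₂

HypEq : Hyp → Hyp → Set
HypEq = Permutation SeqEq

data Extra : Set where
  ruleN ruleT ruleW ruleC ruleA : Extra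

data Has : Logic → Extra → Set where
  nn-N  : Has NN≼ ruleN
  nt-T  : Has NT≼ ruleT
  nw-T  : Has NW≼ ruleT
  nw-W  : Has NW≼ ruleW
  nc-W  : Has NC≼ ruleW
  nc-C  : Has NC≼ ruleC
  na-A  : Has NA≼ ruleA
  nna-N : Has NNA≼ ruleN
  nna-A : Has NNA≼ ruleA

-- Derivability in H.L  (principal items written at the front; the
-- exchange rule makes this derivability modulo multiset equality)
data H[_]⊢_ (L : Logic) : Hyp → Set where
  exch : ∀ {H H'} → H[ L ]⊢ H → HypEq H H' → H[ L ]⊢ H'
  init : ∀ {G Γ Δ Bs p} →
    H[ L ]⊢ ((atom p ∷ Γ) ⇒ (atom p ∷ Δ) ∣ Bs ∷ G)
  botL : ∀ {G Γ Δ Bs} →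
    H[ L ]⊢ ((bot ∷ Γ) ⇒ Δ ∣ Bs ∷ G)
  impL : ∀ {G Γ Δ Bs A B} →
    H[ L ]⊢ ((B ∷ (A ⊃ B) ∷ Γ) ⇒ Δ ∣ Bs ∷ G) →
    H[ L ]⊢ (((A ⊃ B) ∷ Γ) ⇒ (A ∷ Δ) ∣ Bs ∷ G) →
    H[ L ]⊢ (((A ⊃ B) ∷ Γ) ⇒ Δ ∣ Bs ∷ G)
  impR : ∀ {G Γ Δ Bs A B} →
    H[ L ]⊢ ((A ∷ Γ) ⇒ (B ∷ (A ⊃ B) ∷ Δ) ∣ Bs ∷ G) →
    H[ L ]⊢ (Γ ⇒ ((A ⊃ B) ∷ Δ) ∣ Bs ∷ G)
  precL : ∀ {G Γ Δ Bs A B C Σ} →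
    H[ L ]⊢ (((A ≼ B) ∷ Γ) ⇒ Δ ∣ ([ B ∷ Σ ◁ C ] ∷ Bs) ∷ G) →
    H[ L ]⊢ (((A ≼ B) ∷ Γ) ⇒ Δ ∣ ([ Σ ◁ C ] ∷ [ Σ ◁ A ] ∷ Bs) ∷ G) →
    H[ L ]⊢ (((A ≼ B) ∷ Γ) ⇒ Δ ∣ ([ Σ ◁ C ] ∷ Bs) ∷ G)
  precR : ∀ {G Γ Δ Bs A B} →
    H[ L ]⊢ (Γ ⇒ ((A ≼ B) ∷ Δ) ∣ ([ A ∷ [] ◁ B ] ∷ Bs) ∷ G) →
    H[ L ]⊢ (Γ ⇒ ((A ≼ B) ∷ Δ) ∣ Bs ∷ G)
  jp : ∀ {G Γ Δ Bs A Σ} →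
    H[ L ]⊢ ((Γ ⇒ Δ ∣ ([ Σ ◁ A ] ∷ Bs)) ∷ ((A ∷ []) ⇒ Σ ∣ []) ∷ G) →
    H[ L ]⊢ ((Γ ⇒ Δ ∣ ([ Σ ◁ A ] ∷ Bs)) ∷ G)
  rN : Has L ruleN → ∀ {G Γ Δ Bs} →
    H[ L ]⊢ (Γ ⇒ Δ ∣ ([ bot ∷ [] ◁ top ] ∷ Bs) ∷ G) →
    H[ L ]⊢ (Γ ⇒ Δ ∣ Bs ∷ G)
  rT : Has L ruleT → ∀ {G Γ Δ Bs A B} →
    H[ L ]⊢ (((A ≼ B) ∷ Γ) ⇒ (B ∷ Δ) ∣ Bs ∷ G) →
    H[ L ]⊢ (((A ≼ B) ∷ Γ) ⇒ Δ ∣ ([ bot ∷ [] ◁ A ] ∷ Bs) ∷ G) →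
    H[ L ]⊢ (((A ≼ B) ∷ Γ) ⇒ Δ ∣ Bs ∷ G)
  rW : Has L ruleW → ∀ {G Γ Δ Bs A Σ} →
    H[ L ]⊢ (Γ ⇒ (Σ ++ Δ) ∣ ([ Σ ◁ A ] ∷ Bs) ∷ G) →
    H[ L ]⊢ (Γ ⇒ Δ ∣ ([ Σ ◁ A ] ∷ Bs) ∷ G)
  rC : Has L ruleC → ∀ {G Γ Δ Bs A B} →
    H[ L ]⊢ (((A ≼ B) ∷ Γ) ⇒ (B ∷ Δ) ∣ Bs ∷ G) →
    H[ L ]⊢ ((A ∷ (A ≼ B) ∷ Γ) ⇒ Δ ∣ Bs ∷ G) →
    H[ L ]⊢ (((A ≼ B) ∷ Γ) ⇒ Δ ∣ Bs ∷ G)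
  rAL : Has L ruleA → ∀ {G Γ Δ Bs Ω Θ Cs A B} →
    H[ L ]⊢ ((((A ≼ B) ∷ Γ) ⇒ Δ ∣ Bs) ∷ (((A ≼ B) ∷ Ω) ⇒ Θ ∣ Cs) ∷ G) →
    H[ L ]⊢ ((((A ≼ B) ∷ Γ) ⇒ Δ ∣ Bs) ∷ (Ω ⇒ Θ ∣ Cs) ∷ G)
  rAR : Has L ruleA → ∀ {G Γ Δ Bs Ω Θ Cs A B} →
    H[ L ]⊢ ((Γ ⇒ ((A ≼ B) ∷ Δ) ∣ Bs) ∷ (Ω ⇒ ((A ≼ B) ∷ Θ) ∣ Cs) ∷ G) →
    H[ L ]⊢ ((Γ ⇒ ((A ≼ B) ∷ Δ) ∣ Bs) ∷ (Ω ⇒ Θ ∣ Cs) ∷ G)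

⇒[_] : Fm → Hyp
⇒[ A ] = ([] ⇒ (A ∷ []) ∣ []) ∷ []

LEM : Set₂
LEM = ∀ (P : Set₁) → P ⊎ ¬ P

{-# OPTIONS --safe #-}
module Submission where

open import Defs
open import Data.List using ([]; _∷_; _++_)
open import Data.List.Relation.Unary.Any using (Any; here; there)
open import Data.List.Relation.Unary.Any.Properties using (++⁻)
open import Data.List.Relation.Unary.All using (All; []; _∷_)
open import Data.List.Relation.Binary.Permutation.Propositional using (↭-sym)
open import Data.List.Relation.Binary.Permutation.Propositional.Properties
  using (Any-resp-↭; All-resp-↭)
open import Data.List.Relation.Binary.Permutation.Homogeneous
  using (Permutation; refl; prep; swap; trans)
open import Data.List.Relation.Binary.Pointwise.Base using (Pointwise; _∷_)
open import Data.Product using (Σ; _×_; _,_; proj₁; proj₂)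
open import Data.Sum using (_⊎_; inj₁; inj₂)
open import Data.Empty using (⊥-elim) renaming (⊥ to Empty)
open import Relation.Binary.PropositionalEquality using (_≡_; refl)

-- Read a block [Σ ◁ A] at a world as (⋁ Σ) ≼ A, a sequent with blocks as
-- the usual implication, and a hypersequent at a world w₀ as the disjunction
-- over its components of "the component holds at every world linked to w₀",
-- where every world is linked to w₀, except for the calculi with the rules A,
-- where the linked worlds are those with the same neighbourhoods as w₀.  By
-- condition (A) the worlds of a neighbourhood of a linked world are linked,
-- which makes jp sound; that ≼-formulas hold at all linked worlds or at none
-- makes the rules A sound.  Excluded middle is used for →R and for the rules A.

Any-resp-Permutation : ∀ {a r p} {A : Set a} {R : A → A → Set r} {P : A → Set p} →
  (∀ {x y} → R x y → P x → P y) →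
  ∀ {xs ys} → Permutation R xs ys → Any P xs → Any P ys
Any-resp-Permutation {P = P} resp (refl xs≈ys) = pointwise xs≈ys
  where
  pointwise : ∀ {xs ys} → Pointwise _ xs ys → Any P xs → Any P ys
  pointwise (x≈y ∷ _)    (here px)  = here (resp x≈y px)
  pointwise (_ ∷ xs≈ys) (there pxs) = there (pointwise xs≈ys pxs)
Any-resp-Permutation resp (prep x≈y p) (here px)           = here (resp x≈y px)
Any-resp-Permutation resp (prep x≈y p) (there pxs)         = there (Any-resp-Permutation resp p pxs)
Any-resp-Permutation resp (swap x≈y _ p) (here px)         = there (here (resp x≈y px))
Any-resp-Permutation resp (swap _ y≈x p) (there (here px)) = here (resp y≈x px)
Any-resp-Permutation resp (swap _ _ p) (there (there pxs)) = there (there (Any-resp-Permutation resp p pxs))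
Any-resp-Permutation resp (trans p q) pxs                  = Any-resp-Permutation resp q (Any-resp-Permutation resp p pxs)

module Semantics (M : Model) where
  open Model M

  infix 4 _⊨_ _⊨ᴮ_ _⊨ˢ_

  _⊨_ : W → Fm → Set₁
  _⊨_ = _⊩_ M

  _⊨ᴮ_ : W → Block → Set₁
  w ⊨ᴮ [ Φ ◁ A ] = ∀ α → N w α →
    Σ W (λ v → α v × v ⊨ A) → Σ W (λ u → α u × Any (u ⊨_) Φ)

  _⊨ˢ_ : W → Seq → Set₁
  w ⊨ˢ (Γ ⇒ Δ ∣ Bs) = All (w ⊨_) Γ → Any (w ⊨_) Δ ⊎ Any (w ⊨ᴮ_) Bs

  ⊨ᴮ-resp : ∀ {w b c} → BlockEq b c → w ⊨ᴮ b → w ⊨ᴮ c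
  ⊨ᴮ-resp {b = [ _ ◁ _ ]} {[ _ ◁ _ ]} (Φ↭Ψ , refl) b α n x =
    let u , αu , φ = b α n x in u , αu , Any-resp-↭ Φ↭Ψ φ

  ⊨ˢ-resp : ∀ {w s t} → SeqEq s t → w ⊨ˢ s → w ⊨ˢ t
  ⊨ˢ-resp {s = _ ⇒ _ ∣ _} {_ ⇒ _ ∣ _} (Γ↭ , Δ↭ , Bs↭) s γ
    with s (All-resp-↭ (↭-sym Γ↭) γ)
  ... | inj₁ δ = inj₁ (Any-resp-↭ Δ↭ δ)
  ... | inj₂ β = inj₂ (Any-resp-Permutation ⊨ᴮ-resp Bs↭ β)

  SameNbhd : W → W → Set₁
  SameNbhd w v = ∀ β → (N v β → N w β) × (N w β → N v β)

  sameNbhd-refl : ∀ {w} → SameNbhd w w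
  sameNbhd-refl β = (λ n → n) , (λ n → n)

  sameNbhd-sym : ∀ {w v} → SameNbhd w v → SameNbhd v w
  sameNbhd-sym e β = proj₂ (e β) , proj₁ (e β)

  sameNbhd-trans : ∀ {u v w} → SameNbhd u v → SameNbhd v w → SameNbhd u w
  sameNbhd-trans e f β = (λ n → proj₁ (e β) (proj₁ (f β) n))
                       , (λ n → proj₂ (f β) (proj₂ (e β) n))

  ≼-resp-SameNbhd : ∀ {w v A B} → SameNbhd w v → w ⊨ A ≼ B → v ⊨ A ≼ B
  ≼-resp-SameNbhd e p α n = p α (proj₁ (e α) n)

  ◁-singleton⇒≼ : ∀ {w A B} → w ⊨ᴮ [ A ∷ [] ◁ B ] → w ⊨ A ≼ B
  ◁-singleton⇒≼ b α n x with b α n x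
  ... | u , αu , here a = u , αu , a

  ◁-cut : ∀ {w A B C Φ} → w ⊨ A ≼ B →
          w ⊨ᴮ [ B ∷ Φ ◁ C ] → w ⊨ᴮ [ Φ ◁ A ] → w ⊨ᴮ [ Φ ◁ C ]
  ◁-cut p bc ba α n x with bc α n x
  ... | u , αu , there φ = u , αu , φ
  ... | u , αu , here b  = ba α n (p α n (u , αu , b))

  drop-false-block : ∀ {w Γ Δ b Bs} → (w ⊨ᴮ b → Empty) →
                     w ⊨ˢ (Γ ⇒ Δ ∣ (b ∷ Bs)) → w ⊨ˢ (Γ ⇒ Δ ∣ Bs)
  drop-false-block ¬b s γ with s γ
  ... | inj₁ δ         = inj₁ δ
  ... | inj₂ (here b)  = ⊥-elim (¬b b)
  ... | inj₂ (there β) = inj₂ β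

  drop-false-formula : ∀ {w Γ Δ A Bs} → (w ⊨ A → Empty) →
                       w ⊨ˢ (Γ ⇒ (A ∷ Δ) ∣ Bs) → w ⊨ˢ (Γ ⇒ Δ ∣ Bs)
  drop-false-formula ¬a s γ with s γ
  ... | inj₁ (here a)  = ⊥-elim (¬a a)
  ... | inj₁ (there δ) = inj₁ δ
  ... | inj₂ β         = inj₂ β

  impL-sound : ∀ {w Γ Δ Bs A B} →
    w ⊨ˢ ((B ∷ (A ⊃ B) ∷ Γ) ⇒ Δ ∣ Bs) → w ⊨ˢ (((A ⊃ B) ∷ Γ) ⇒ (A ∷ Δ) ∣ Bs) →
    w ⊨ˢ (((A ⊃ B) ∷ Γ) ⇒ Δ ∣ Bs)
  impL-sound s t γ@(i ∷ _) with t γ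
  ... | inj₁ (here a)  = s (i a ∷ γ)
  ... | inj₁ (there δ) = inj₁ δ
  ... | inj₂ β         = inj₂ β

  impR-sound : LEM → ∀ {w Γ Δ Bs A B} →
    w ⊨ˢ ((A ∷ Γ) ⇒ (B ∷ (A ⊃ B) ∷ Δ) ∣ Bs) → w ⊨ˢ (Γ ⇒ ((A ⊃ B) ∷ Δ) ∣ Bs)
  impR-sound lem {w} {A = A} s γ with lem (w ⊨ A)
  ... | inj₂ ¬a = inj₁ (here (λ a → ⊥-elim (¬a a)))
  ... | inj₁ a with s (a ∷ γ)
  ...   | inj₁ (here b)  = inj₁ (here (λ _ → b))
  ...   | inj₁ (there δ) = inj₁ δ
  ...   | inj₂ β         = inj₂ β

  precL-sound : ∀ {w Γ Δ Bs A B C Φ} →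
    w ⊨ˢ (((A ≼ B) ∷ Γ) ⇒ Δ ∣ ([ B ∷ Φ ◁ C ] ∷ Bs)) →
    w ⊨ˢ (((A ≼ B) ∷ Γ) ⇒ Δ ∣ ([ Φ ◁ C ] ∷ [ Φ ◁ A ] ∷ Bs)) →
    w ⊨ˢ (((A ≼ B) ∷ Γ) ⇒ Δ ∣ ([ Φ ◁ C ] ∷ Bs))
  precL-sound s t γ@(p ∷ _) with s γ | t γ
  ... | inj₁ δ          | _                      = inj₁ δ
  ... | inj₂ (there β)  | _                      = inj₂ (there β)
  ... | inj₂ (here _)   | inj₁ δ                 = inj₁ δ
  ... | inj₂ (here _)   | inj₂ (here c)          = inj₂ (here c)
  ... | inj₂ (here bc)  | inj₂ (there (here ba)) = inj₂ (here (◁-cut p bc ba))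
  ... | inj₂ (here _)   | inj₂ (there (there β)) = inj₂ (there β)

  precR-sound : ∀ {w Γ Δ Bs A B} →
    w ⊨ˢ (Γ ⇒ ((A ≼ B) ∷ Δ) ∣ ([ A ∷ [] ◁ B ] ∷ Bs)) →
    w ⊨ˢ (Γ ⇒ ((A ≼ B) ∷ Δ) ∣ Bs)
  precR-sound s γ with s γ
  ... | inj₁ δ         = inj₁ δ
  ... | inj₂ (here b)  = inj₁ (here (◁-singleton⇒≼ b))
  ... | inj₂ (there β) = inj₂ β

  ◁-bot-top-absurd : CondN M → ∀ {w} → w ⊨ᴮ [ bot ∷ [] ◁ top ] → Empty
  ◁-bot-top-absurd condN {w} b with condN w
  ... | α , n with noEmp w α n
  ...   | v , αv with b α n (v , αv , λ f → f)
  ...     | _ , _ , here ()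

  ◁-bot-absurd : CondT M → ∀ {w A B} → w ⊨ A ≼ B → w ⊨ B → w ⊨ᴮ [ bot ∷ [] ◁ A ] → Empty
  ◁-bot-absurd condT {w} p b bl with condT w
  ... | α , n , αw with bl α n (p α n (w , αw , b))
  ...   | _ , _ , here ()

  ◁-reflexive : CondW M → ∀ {w A Φ} → Any (w ⊨_) Φ → w ⊨ᴮ [ Φ ◁ A ]
  ◁-reflexive condW {w} φ α n _ = w , proj₂ (condW w) α n , φ

  ≼-centred : CondC M → ∀ {w A B} → w ⊨ A ≼ B → w ⊨ B → w ⊨ A
  ≼-centred condC {w} p b with p (_≡ w) (proj₁ (condC w)) (w , refl , b)
  ... | _ , refl , a = a

  N-sound : CondN M → ∀ {w Γ Δ Bs} →
    w ⊨ˢ (Γ ⇒ Δ ∣ ([ bot ∷ [] ◁ top ] ∷ Bs)) → w ⊨ˢ (Γ ⇒ Δ ∣ Bs)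
  N-sound condN = drop-false-block (◁-bot-top-absurd condN)

  T-sound : CondT M → ∀ {w Γ Δ Bs A B} →
    w ⊨ˢ (((A ≼ B) ∷ Γ) ⇒ (B ∷ Δ) ∣ Bs) →
    w ⊨ˢ (((A ≼ B) ∷ Γ) ⇒ Δ ∣ ([ bot ∷ [] ◁ A ] ∷ Bs)) →
    w ⊨ˢ (((A ≼ B) ∷ Γ) ⇒ Δ ∣ Bs)
  T-sound condT s t γ@(p ∷ _) with s γ
  ... | inj₁ (here b)  = drop-false-block (◁-bot-absurd condT p b) t γ
  ... | inj₁ (there δ) = inj₁ δ
  ... | inj₂ β         = inj₂ β

  W-sound : CondW M → ∀ {w Γ Δ Bs A Φ} →
    w ⊨ˢ (Γ ⇒ (Φ ++ Δ) ∣ ([ Φ ◁ A ] ∷ Bs)) →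
    w ⊨ˢ (Γ ⇒ Δ ∣ ([ Φ ◁ A ] ∷ Bs))
  W-sound condW {Φ = Φ} s γ with s γ
  ... | inj₂ β = inj₂ β
  ... | inj₁ δ with ++⁻ Φ δ
  ...   | inj₁ φ  = inj₂ (here (◁-reflexive condW φ))
  ...   | inj₂ δ′ = inj₁ δ′

  C-sound : CondC M → ∀ {w Γ Δ Bs A B} →
    w ⊨ˢ (((A ≼ B) ∷ Γ) ⇒ (B ∷ Δ) ∣ Bs) →
    w ⊨ˢ ((A ∷ (A ≼ B) ∷ Γ) ⇒ Δ ∣ Bs) →
    w ⊨ˢ (((A ≼ B) ∷ Γ) ⇒ Δ ∣ Bs)
  C-sound condC s t γ@(p ∷ _) with s γ
  ... | inj₁ (here b)  = t (≼-centred condC p b ∷ γ)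
  ... | inj₁ (there δ) = inj₁ δ
  ... | inj₂ β         = inj₂ β

module Soundness (L : Logic) (M : Model) (isM : IsModelOf L M) where
  open Model M
  open Semantics M

  condN : Has L ruleN → CondN M
  condN nn-N  = isM
  condN nna-N = proj₁ isM

  condT : Has L ruleT → CondT M
  condT nt-T = isM
  condT nw-T w = let α , n = proj₁ (isM w) in α , n , proj₂ (isM w) α n

  condW : Has L ruleW → CondW M
  condW nw-W = isM
  condW nc-W w = let n , contains = isM w in (_ , n) , contains

  condC : Has L ruleC → CondC M
  condC nc-C = isM

  condA : Has L ruleA → CondA M
  condA na-A  = isM
  condA nna-A = proj₂ isM

  -- Trivial unless the calculus has the rules A.
  Linked : W → W → Set₁
  Linked w v = Has L ruleA → SameNbhd w v

  linked-refl : ∀ {w} → Linked w w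
  linked-refl _ = sameNbhd-refl

  linked-step : ∀ {w₀ w α v} → Linked w₀ w → N w α → α v → Linked w₀ v
  linked-step e n αv h = sameNbhd-trans (e h) (condA h _ _ _ n αv)

  ≼-resp-Linked : Has L ruleA → ∀ {w₀ w v A B} →
                  Linked w₀ w → Linked w₀ v → w ⊨ A ≼ B → v ⊨ A ≼ B
  ≼-resp-Linked h e f = ≼-resp-SameNbhd (sameNbhd-trans (sameNbhd-sym (e h)) (f h))

  _⊨ᶜ_ : W → Seq → Set₁
  w₀ ⊨ᶜ s = ∀ w → Linked w₀ w → w ⊨ˢ s

  Valid : Hyp → Set₁
  Valid H = ∀ w₀ → Any (w₀ ⊨ᶜ_) H

  valid-axiom : ∀ {s G} → (∀ {w} → w ⊨ˢ s) → Valid (s ∷ G)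
  valid-axiom s _ = here (λ _ _ → s)

  valid-rule₁ : ∀ {s s′ G} → (∀ {w} → w ⊨ˢ s → w ⊨ˢ s′) →
                Valid (s ∷ G) → Valid (s′ ∷ G)
  valid-rule₁ r v w₀ with v w₀
  ... | here c  = here (λ w e → r (c w e))
  ... | there g = there g

  valid-rule₂ : ∀ {s t s′ G} → (∀ {w} → w ⊨ˢ s → w ⊨ˢ t → w ⊨ˢ s′) →
                Valid (s ∷ G) → Valid (t ∷ G) → Valid (s′ ∷ G)
  valid-rule₂ r v u w₀ with v w₀ | u w₀
  ... | there g | _       = there g
  ... | here _  | there g = there g
  ... | here c  | here d  = here (λ w e → r (c w e) (d w e))

  jp-sound : ∀ {Γ Δ Bs A Φ G} →
    Valid ((Γ ⇒ Δ ∣ ([ Φ ◁ A ] ∷ Bs)) ∷ ((A ∷ []) ⇒ Φ ∣ []) ∷ G) →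
    Valid ((Γ ⇒ Δ ∣ ([ Φ ◁ A ] ∷ Bs)) ∷ G)
  jp-sound {Φ = Φ} v w₀ with v w₀
  ... | here c          = here c
  ... | there (there g) = there g
  ... | there (here c)  = here λ w e _ → inj₂ (here (λ α n (u , αu , a) →
          u , αu , succedent (c u (linked-step e n αu) (a ∷ []))))
    where
    succedent : ∀ {u} → Any (u ⊨_) Φ ⊎ Any (u ⊨ᴮ_) [] → Any (u ⊨_) Φ
    succedent (inj₁ φ) = φ

  AL-sound : LEM → Has L ruleA → ∀ {Γ Δ Bs Ω Θ Cs A B G} →
    Valid ((((A ≼ B) ∷ Γ) ⇒ Δ ∣ Bs) ∷ (((A ≼ B) ∷ Ω) ⇒ Θ ∣ Cs) ∷ G) →
    Valid ((((A ≼ B) ∷ Γ) ⇒ Δ ∣ Bs) ∷ (Ω ⇒ Θ ∣ Cs) ∷ G)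
  AL-sound lem h {A = A} {B} v w₀ with v w₀
  ... | here c          = here c
  ... | there (there g) = there (there g)
  ... | there (here c) with lem (Σ W (λ w → Linked w₀ w × w ⊨ A ≼ B))
  ...   | inj₁ (w₁ , e₁ , p) = there (here (λ w e γ → c w e (≼-resp-Linked h e₁ e p ∷ γ)))
  ...   | inj₂ none          = here (λ w e → λ { (p ∷ _) → ⊥-elim (none (w , e , p)) })

  AR-sound : LEM → Has L ruleA → ∀ {Γ Δ Bs Ω Θ Cs A B G} →
    Valid ((Γ ⇒ ((A ≼ B) ∷ Δ) ∣ Bs) ∷ (Ω ⇒ ((A ≼ B) ∷ Θ) ∣ Cs) ∷ G) →
    Valid ((Γ ⇒ ((A ≼ B) ∷ Δ) ∣ Bs) ∷ (Ω ⇒ Θ ∣ Cs) ∷ G)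
  AR-sound lem h {A = A} {B} v w₀ with v w₀
  ... | here c          = here c
  ... | there (there g) = there (there g)
  ... | there (here c) with lem (Σ W (λ w → Linked w₀ w × w ⊨ A ≼ B))
  ...   | inj₁ (w₁ , e₁ , p) = here (λ w e _ → inj₁ (here (≼-resp-Linked h e₁ e p)))
  ...   | inj₂ none          =
    there (here λ w e → drop-false-formula (λ p → none (w , e , p)) (c w e))

  soundness : LEM → ∀ {H} → H[ L ]⊢ H → Valid H
  soundness lem (exch d H≈H′) w₀ =
    Any-resp-Permutation (λ s≈t c w e → ⊨ˢ-resp s≈t (c w e)) H≈H′ (soundness lem d w₀)
  soundness lem init          = valid-axiom λ { (p ∷ _) → inj₁ (here p) }
  soundness lem botL          = valid-axiom λ { (() ∷ _) }
  soundness lem (impL d e)    = valid-rule₂ impL-sound (soundness lem d) (soundness lem e)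
  soundness lem (impR d)      = valid-rule₁ (impR-sound lem) (soundness lem d)
  soundness lem (precL d e)   = valid-rule₂ precL-sound (soundness lem d) (soundness lem e)
  soundness lem (precR d)     = valid-rule₁ precR-sound (soundness lem d)
  soundness lem (jp d)        = jp-sound (soundness lem d)
  soundness lem (rN h d)      = valid-rule₁ (N-sound (condN h)) (soundness lem d)
  soundness lem (rT h d e)    = valid-rule₂ (T-sound (condT h)) (soundness lem d) (soundness lem e)
  soundness lem (rW h d)      = valid-rule₁ (W-sound (condW h)) (soundness lem d)
  soundness lem (rC h d e)    = valid-rule₂ (C-sound (condC h)) (soundness lem d) (soundness lem e)
  soundness lem (rAL h d)     = AL-sound lem h (soundness lem d)
  soundness lem (rAR h d)     = AR-sound lem h (soundness lem d)

theorem5p2 : LEM → ∀ (L : Logic) (A : Fm) → H[ L ]⊢ ⇒[ A ] → ValidL L A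
theorem5p2 lem L A d M isM w with Soundness.soundness L M isM lem d w
... | here valid with valid w (Soundness.linked-refl L M isM) []
...   | inj₁ (here a) = a
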